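{- Let $\{\gamma_{i,j}\}_{(i,j)\in St_n}$ be a cylindrical growth diagram for $SL_3$ and let $1\le i\le n$. For $i+1\le j\le i+n$ let $\operatorname{dif}(\gamma_{i,j},\gamma_{i+1,j})\subseteq\{1,2,3\}$ denote the set of row indices in which the partitions $\gamma_{i,j}$ and $\gamma_{i+1,j}$ differ. (a) Suppose $\gamma_{i,i+1}=(1,0,0)$. Then $\operatorname{dif}(\gamma_{i,i+1},\gamma_{i+1,i+1})=\{1\}$, $\operatorname{dif}(\gamma_{i,i+n},\gamma_{i+1,i+n})=\{3\}$, and $\operatorname{dif}(\gamma_{i,j},\gamma_{i+1,j})$ is a set of size $1$ for all $i+1\le j\le i+n$ which increases weakly monotonically (with respect to $\{1\}<\{2\}<\{3\}$) from $\{1\}$ to $\{3\}$ as $j$ increases from $i+1$ to $i+n$. (b) Suppose $\gamma_{i,i+1}=(1,1,0)$. Then $\operatorname{dif}(\gamma_{i,i+1},\gamma_{i+1,i+1})=\{1,2\}$, $\operatorname{dif}(\gamma_{i,i+n},\gamma_{i+1,i+n})=\{2,3\}$, and $\operatorname{dif}(\gamma_{i,j},\gamma_{i+1,j})$ is a set of size $2$ for all $i+1\le j\le i+n$ which increases weakly monotonically (with respect to $\{1,2\}<\{1,3\}<\{2,3\}$) from $\{1,2\}$ to $\{2,3\}$ as $j$ increases from $i+1$ to $i+n$.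
   Context: Partitions here have at most $3$ parts, written $(p_1,p_2,p_3)$ with $p_1\ge p_2\ge p_3\ge 0$. For partitions $\delta\subseteq\gamma$, the skew shape $\gamma/\delta$ is a vertical strip if $\gamma_k-\delta_k\in\{0,1\}$ for each $k$. For an integer vector $v$, $\operatorname{sort}(v)$ is its rearrangement into weakly decreasing order. Let $St_n=\{(i,j)\in\mathbb Z^2: 1\le i\le n+1,\ i\le j\le i+n\}$. A cylindrical growth diagram for $SL_3$ of shape $\pi=(k,k,k)$ is an assignment of a partition $\gamma_{i,j}$ to each $(i,j)\in St_n$ such that: $\gamma_{i,j}/\gamma_{i+1,j}$ and $\gamma_{i,j}/\gamma_{i,j-1}$ are vertical strips whenever both entries are defined; $\gamma_{i,i}=\emptyset$ for all $i$; $\gamma_{i,i+n}=\pi$ for all $i$; and for every unit square with all four corners in $St_n$, $\gamma_{i+1,j+1}=\operatorname{sort}(\gamma_{i+1,j}+\gamma_{i,j+1}-\gamma_{i,j})$. -}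

module Defs where

open import Data.Nat using (ℕ; zero; suc; _+_; _≤_)
open import Data.Nat.Properties using (_≟_)
open import Data.Integer as ℤ using (ℤ; +_; _-_)
import Data.Integer.Properties as ℤP
open import Data.Bool using (Bool; true; false; not)
open import Data.Product using (_×_; _,_; proj₁; proj₂)
open import Data.Sum using (_⊎_)
open import Data.Vec using (Vec; []; _∷_)
open import Data.Fin.Subset using (Subset)
open import Relation.Nullary.Decidable using (does)
open import Relation.Binary.PropositionalEquality using (_≡_)

Triple : Set
Triple = ℕ × ℕ × ℕ

row₁ row₂ row₃ : Triple → ℕ
row₁ (a , b , c) = a
row₂ (a , b , c) = b
row₃ (a , b , c) = c

IsPartition : Triple → Set
IsPartition (a , b , c) = b ≤ a × c ≤ b

empty : Triple
empty = (0 , 0 , 0)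

rect : ℕ → Triple
rect k = (k , k , k)

VStrip1 : ℕ → ℕ → Set
VStrip1 g d = g ≡ d ⊎ g ≡ suc d

VerticalStrip : Triple → Triple → Set
VerticalStrip (g₁ , g₂ , g₃) (d₁ , d₂ , d₃) =
  VStrip1 g₁ d₁ × VStrip1 g₂ d₂ × VStrip1 g₃ d₃

ZTriple : Set
ZTriple = ℤ × ℤ × ℤ

toZ : Triple → ZTriple
toZ (a , b , c) = (+ a , + b , + c)

sort3 : ZTriple → ZTriple
sort3 (a , b , c) =
  let hi₁ = a ℤ.⊔ b ; lo₁ = a ℤ.⊓ b
      top = hi₁ ℤ.⊔ c ; r = hi₁ ℤ.⊓ c
      mid = lo₁ ℤ.⊔ r ; bot = lo₁ ℤ.⊓ r
  in (top , mid , bot)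

plusMinus : Triple → Triple → Triple → ZTriple
plusMinus (u₁ , u₂ , u₃) (v₁ , v₂ , v₃) (w₁ , w₂ , w₃) =
  ((+ u₁ ℤ.+ + v₁) - + w₁ , (+ u₂ ℤ.+ + v₂) - + w₂ , (+ u₃ ℤ.+ + v₃) - + w₃)

InSt : ℕ → ℕ → ℕ → Set
InSt n i j = 1 ≤ i × i ≤ suc n × i ≤ j × j ≤ i + n

-- A cylindrical growth diagram for SL₃ of shape (k,k,k) on St_n.
-- γ is a function on ℕ², only its values on St_n matter.
record CylGrowthDiagram (n k : ℕ) (γ : ℕ → ℕ → Triple) : Set where
  field
    partition : ∀ i j → InSt n i j → IsPartition (γ i j)
    vstrip-col : ∀ i j → InSt n i j → InSt n (suc i) j →
                 VerticalStrip (γ i j) (γ (suc i) j)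
    vstrip-row : ∀ i j → InSt n i (suc j) → InSt n i j →
                 VerticalStrip (γ i (suc j)) (γ i j)
    diag-empty : ∀ i → InSt n i i → γ i i ≡ empty
    top-shape  : ∀ i → InSt n i (i + n) → γ i (i + n) ≡ rect k
    local-rule : ∀ i j → InSt n i j → InSt n (suc i) j → InSt n i (suc j) →
                 InSt n (suc i) (suc j) →
                 toZ (γ (suc i) (suc j)) ≡
                   sort3 (plusMinus (γ (suc i) j) (γ i (suc j)) (γ i j))

-- dif(γ, δ) ⊆ {1,2,3}: rows in which γ and δ differ (row r ↦ Fin index r-1)
dif : Triple → Triple → Subset 3
dif (a₁ , a₂ , a₃) (b₁ , b₂ , b₃) =
  not (does (a₁ ≟ b₁)) ∷ not (does (a₂ ≟ b₂)) ∷ not (does (a₃ ≟ b₃)) ∷ []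

rank1 : Subset 3 → ℕ
rank1 (true  ∷ _     ∷ _    ∷ []) = 0
rank1 (false ∷ true  ∷ _    ∷ []) = 1
rank1 (false ∷ false ∷ _    ∷ []) = 2

rank2 : Subset 3 → ℕ
rank2 (true  ∷ true  ∷ _ ∷ []) = 0
rank2 (true  ∷ false ∷ _ ∷ []) = 1
rank2 (false ∷ _     ∷ _ ∷ []) = 2

module Submission where

-- Let xⱼ be the 0/1 vector of dif(γ_{i,j}, γ_{i+1,j}), so that the vertical strip
-- condition reads γ_{i,j} = γ_{i+1,j} + xⱼ. Substituting this into the local rule at the
-- square with corner (i, j) gives γ_{i+1,j+1} = sort(γ_{i+1,j+1} + x_{j+1} − xⱼ). A sorted
-- vector dominates the vector it sorts, so xⱼ dominates x_{j+1}: along the row the xⱼ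
-- descend in dominance order and keep their size. The first one is γ_{i,i+1} itself, as
-- γ_{i+1,i+1} = ∅; the last one is (k,k,k) minus a partition, hence upward closed, which
-- pins it down. On 0/1 vectors of size 1 or 2, descending in dominance order is ascending
-- in the stated orders.

open import Defs
open import Data.Nat using (ℕ; suc; _+_; _≤_)
open import Data.Product using (_×_; _,_)
open import Data.Fin using (zero; suc)
open import Data.Fin.Subset using (⁅_⁆; ∣_∣; _∪_)
open import Relation.Binary.PropositionalEquality using (_≡_)

open import Data.Bool using (Bool; true; false; not)
open import Data.Fin using (Fin)
open import Data.Fin.Subset using (Subset)
open import Data.Integer as ℤ using (ℤ; +_; _-_)
import Data.Integer.Properties as ℤP
import Data.Integer.Tactic.RingSolver as ℤSolver
import Data.Nat.Tactic.RingSolver as ℕSolver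
open import Data.Nat using (z≤n; s≤s; _∸_; _≤′_; ≤′-refl; ≤′-step)
import Data.Nat.Properties as ℕP
open import Data.Nat.Properties using (_≟_)
open import Data.Sum using (inj₁; inj₂)
open import Data.Vec using ([]; _∷_)
open import Function using (flip)
open import Relation.Binary.Definitions using (Reflexive; Transitive)
open import Relation.Binary.PropositionalEquality
  using (refl; sym; trans; cong; cong₂; subst₂; module ≡-Reasoning)
open import Relation.Nullary.Decidable using (does; dec-true; dec-false)

total : Fin 3
total = suc (suc zero)

prefix : Fin 3 → Triple → ℕ
prefix zero             (a , _ , _) = a
prefix (suc zero)       (a , b , _) = a + b
prefix (suc (suc zero)) (a , b , c) = a + b + c

prefixℤ : Fin 3 → ZTriple → ℤ
prefixℤ zero             (a , _ , _) = a
prefixℤ (suc zero)       (a , b , _) = a ℤ.+ b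
prefixℤ (suc (suc zero)) (a , b , c) = a ℤ.+ b ℤ.+ c

record _⊴_ (u v : Triple) : Set where
  field
    prefix-≤ : ∀ r → prefix r u ≤ prefix r v
    total-≡  : prefix total u ≡ prefix total v

open _⊴_

⊴-refl : Reflexive _⊴_
⊴-refl = record { prefix-≤ = λ _ → ℕP.≤-refl ; total-≡ = refl }

⊴-trans : Transitive _⊴_
⊴-trans u⊴v v⊴w = record
  { prefix-≤ = λ r → ℕP.≤-trans (prefix-≤ u⊴v r) (prefix-≤ v⊴w r)
  ; total-≡  = trans (total-≡ u⊴v) (total-≡ v⊴w)
  }

⊔-+-⊓ : ∀ i j → (i ℤ.⊔ j) ℤ.+ (i ℤ.⊓ j) ≡ i ℤ.+ j
⊔-+-⊓ i j with ℤP.≤-total i j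
... | inj₁ i≤j rewrite ℤP.i≤j⇒i⊔j≡j i≤j | ℤP.i≤j⇒i⊓j≡i i≤j = ℤP.+-comm j i
... | inj₂ j≤i rewrite ℤP.i≥j⇒i⊔j≡i j≤i | ℤP.i≥j⇒i⊓j≡j j≤i = refl

sort3-total : ∀ v → prefixℤ total v ≡ prefixℤ total (sort3 v)
sort3-total (a , b , c) = begin
  a ℤ.+ b ℤ.+ c             ≡⟨ cong (ℤ._+ c) (sym (⊔-+-⊓ a b)) ⟩
  h ℤ.+ l ℤ.+ c             ≡⟨ swap h l c ⟩
  (h ℤ.+ c) ℤ.+ l           ≡⟨ cong (ℤ._+ l) (sym (⊔-+-⊓ h c)) ⟩
  (t ℤ.+ r) ℤ.+ l           ≡⟨ regroup t r l ⟩
  t ℤ.+ (l ℤ.+ r)           ≡⟨ cong (λ q → t ℤ.+ q) (sym (⊔-+-⊓ l r)) ⟩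
  t ℤ.+ ((l ℤ.⊔ r) ℤ.+ (l ℤ.⊓ r)) ≡⟨ sym (ℤP.+-assoc t _ _) ⟩
  prefixℤ total (sort3 (a , b , c)) ∎
  where
  open ≡-Reasoning
  h l t r : ℤ
  h = a ℤ.⊔ b
  l = a ℤ.⊓ b
  t = h ℤ.⊔ c
  r = h ℤ.⊓ c
  swap : ∀ x y z → x ℤ.+ y ℤ.+ z ≡ (x ℤ.+ z) ℤ.+ y
  swap = ℤSolver.solve-∀
  regroup : ∀ x y z → (x ℤ.+ y) ℤ.+ z ≡ x ℤ.+ (z ℤ.+ y)
  regroup = ℤSolver.solve-∀

sort3-dominates : ∀ v r → prefixℤ r v ℤ.≤ prefixℤ r (sort3 v)
sort3-dominates (a , b , c) zero =
  ℤP.≤-trans (ℤP.i≤i⊔j a b) (ℤP.i≤i⊔j (a ℤ.⊔ b) c)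
sort3-dominates (a , b , c) (suc zero) = begin
  a ℤ.+ b                       ≡⟨ sym (⊔-+-⊓ a b) ⟩
  (a ℤ.⊔ b) ℤ.+ (a ℤ.⊓ b)       ≤⟨ ℤP.+-mono-≤ (ℤP.i≤i⊔j (a ℤ.⊔ b) c) (ℤP.i≤i⊔j (a ℤ.⊓ b) _) ⟩
  prefixℤ (suc zero) (sort3 (a , b , c)) ∎
  where open ℤP.≤-Reasoning
sort3-dominates v (suc (suc zero)) = ℤP.≤-reflexive (sort3-total v)

bit : Bool → ℕ
bit false = 0
bit true  = 1

indicator : Subset 3 → Triple
indicator (x ∷ y ∷ z ∷ []) = (bit x , bit y , bit z)

_+₃_ : Triple → Triple → Triple
(a₁ , a₂ , a₃) +₃ (b₁ , b₂ , b₃) = (a₁ + b₁ , a₂ + b₂ , a₃ + b₃)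

vstrip1-split : ∀ {g d} → VStrip1 g d → g ≡ d + bit (not (does (g ≟ d)))
vstrip1-split {d = d} (inj₁ refl) rewrite dec-true (d ≟ d) refl = sym (ℕP.+-identityʳ d)
vstrip1-split {d = d} (inj₂ refl) rewrite dec-false (suc d ≟ d) ℕP.1+n≢n = ℕP.+-comm 1 d

vstrip-split : ∀ {γ δ} → VerticalStrip γ δ → γ ≡ δ +₃ indicator (dif γ δ)
vstrip-split (v₁ , v₂ , v₃) =
  cong₂ _,_ (vstrip1-split v₁) (cong₂ _,_ (vstrip1-split v₂) (vstrip1-split v₃))

prefix-+₃ : ∀ r u v → prefix r (u +₃ v) ≡ prefix r u + prefix r v
prefix-+₃ zero             _                _                = refl
prefix-+₃ (suc zero)       (a₁ , a₂ , _)   (b₁ , b₂ , _)   = interchange a₁ b₁ a₂ b₂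
  where
  interchange : ∀ a₁ b₁ a₂ b₂ → (a₁ + b₁) + (a₂ + b₂) ≡ (a₁ + a₂) + (b₁ + b₂)
  interchange = ℕSolver.solve-∀
prefix-+₃ (suc (suc zero)) (a₁ , a₂ , a₃) (b₁ , b₂ , b₃) = interchange a₁ b₁ a₂ b₂ a₃ b₃
  where
  interchange : ∀ a₁ b₁ a₂ b₂ a₃ b₃ →
    (a₁ + b₁) + (a₂ + b₂) + (a₃ + b₃) ≡ (a₁ + a₂ + a₃) + (b₁ + b₂ + b₃)
  interchange = ℕSolver.solve-∀

prefixℤ-toZ : ∀ r t → prefixℤ r (toZ t) ≡ + prefix r t
prefixℤ-toZ zero             _ = refl
prefixℤ-toZ (suc zero)       _ = refl
prefixℤ-toZ (suc (suc zero)) _ = refl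

prefixℤ-plusMinus : ∀ r u v w →
  prefixℤ r (plusMinus u v w) ≡ (+ prefix r u ℤ.+ + prefix r v) - + prefix r w
prefixℤ-plusMinus zero _ _ _ = refl
prefixℤ-plusMinus (suc zero) (u₁ , u₂ , _) (v₁ , v₂ , _) (w₁ , w₂ , _) =
  collect (+ u₁) (+ v₁) (+ w₁) (+ u₂) (+ v₂) (+ w₂)
  where
  collect : ∀ u₁ v₁ w₁ u₂ v₂ w₂ →
    (u₁ ℤ.+ v₁) - w₁ ℤ.+ ((u₂ ℤ.+ v₂) - w₂) ≡ ((u₁ ℤ.+ u₂) ℤ.+ (v₁ ℤ.+ v₂)) - (w₁ ℤ.+ w₂)
  collect = ℤSolver.solve-∀
prefixℤ-plusMinus (suc (suc zero)) (u₁ , u₂ , u₃) (v₁ , v₂ , v₃) (w₁ , w₂ , w₃) =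
  collect (+ u₁) (+ v₁) (+ w₁) (+ u₂) (+ v₂) (+ w₂) (+ u₃) (+ v₃) (+ w₃)
  where
  collect : ∀ u₁ v₁ w₁ u₂ v₂ w₂ u₃ v₃ w₃ →
    (u₁ ℤ.+ v₁) - w₁ ℤ.+ ((u₂ ℤ.+ v₂) - w₂) ℤ.+ ((u₃ ℤ.+ v₃) - w₃)
      ≡ ((u₁ ℤ.+ u₂ ℤ.+ u₃) ℤ.+ (v₁ ℤ.+ v₂ ℤ.+ v₃)) - (w₁ ℤ.+ w₂ ℤ.+ w₃)
  collect = ℤSolver.solve-∀

residual-identity : ∀ c e x y → ((+ c ℤ.+ + (e + y)) - + (c + x)) ℤ.+ + x ≡ + (e + y)
residual-identity c e x y = identity (+ c) (+ e) (+ x) (+ y)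
  where
  identity : ∀ c e x y → ((c ℤ.+ (e ℤ.+ y)) - (c ℤ.+ x)) ℤ.+ x ≡ e ℤ.+ y
  identity = ℤSolver.solve-∀

residual-≤ : ∀ {a b c e x y} → b ≡ c + x → a ≡ e + y → (+ c ℤ.+ + a) - + b ℤ.≤ + e → y ≤ x
residual-≤ {c = c} {e} {x} {y} refl refl bound =
  ℕP.+-cancelˡ-≤ e y x (ℤP.drop‿+≤+ (begin
    + (e + y)                                    ≡⟨ sym (residual-identity c e x y) ⟩
    ((+ c ℤ.+ + (e + y)) - + (c + x)) ℤ.+ + x    ≤⟨ ℤP.+-monoˡ-≤ (+ x) bound ⟩
    + (e + x)                                    ∎))
  where open ℤP.≤-Reasoning

residual-≡ : ∀ {a b c e x y} → b ≡ c + x → a ≡ e + y → (+ c ℤ.+ + a) - + b ≡ + e → y ≡ x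
residual-≡ {c = c} {e} {x} {y} refl refl eq =
  ℕP.+-cancelˡ-≡ e y x (ℤP.+-injective (begin
    + (e + y)                                    ≡⟨ sym (residual-identity c e x y) ⟩
    ((+ c ℤ.+ + (e + y)) - + (c + x)) ℤ.+ + x    ≡⟨ cong (λ q → q ℤ.+ + x) eq ⟩
    + (e + x)                                    ∎))
  where open ≡-Reasoning

vstrip-prefix : ∀ {γ δ} r → VerticalStrip γ δ →
  prefix r γ ≡ prefix r δ + prefix r (indicator (dif γ δ))
vstrip-prefix r γ/δ = trans (cong (prefix r) (vstrip-split γ/δ)) (prefix-+₃ r _ _)

local-rule-⊴ : ∀ {A B C E} → VerticalStrip B C → VerticalStrip A E →
  toZ E ≡ sort3 (plusMinus C A B) → indicator (dif A E) ⊴ indicator (dif B C)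
local-rule-⊴ {A} {B} {C} {E} B/C A/E rule = record
  { prefix-≤ = λ r → residual-≤ {c = prefix r C} {e = prefix r E}
                        (vstrip-prefix r B/C) (vstrip-prefix r A/E) (rule-≤ r)
  ; total-≡  = residual-≡ {c = prefix total C} {e = prefix total E}
                 (vstrip-prefix total B/C) (vstrip-prefix total A/E) rule-total
  }
  where
  rule-prefix : ∀ r → prefixℤ r (sort3 (plusMinus C A B)) ≡ + prefix r E
  rule-prefix r = trans (cong (prefixℤ r) (sym rule)) (prefixℤ-toZ r E)

  rule-≤ : ∀ r → (+ prefix r C ℤ.+ + prefix r A) - + prefix r B ℤ.≤ + prefix r E
  rule-≤ r = begin
    (+ prefix r C ℤ.+ + prefix r A) - + prefix r B ≡⟨ sym (prefixℤ-plusMinus r C A B) ⟩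
    prefixℤ r (plusMinus C A B)                    ≤⟨ sort3-dominates (plusMinus C A B) r ⟩
    prefixℤ r (sort3 (plusMinus C A B))            ≡⟨ rule-prefix r ⟩
    + prefix r E                                   ∎
    where open ℤP.≤-Reasoning

  rule-total : (+ prefix total C ℤ.+ + prefix total A) - + prefix total B ≡ + prefix total E
  rule-total = begin
    (+ prefix total C ℤ.+ + prefix total A) - + prefix total B ≡⟨ sym (prefixℤ-plusMinus total C A B) ⟩
    prefixℤ total (plusMinus C A B)                            ≡⟨ sort3-total (plusMinus C A B) ⟩
    prefixℤ total (sort3 (plusMinus C A B))                    ≡⟨ rule-prefix total ⟩
    + prefix total E                                           ∎
    where open ≡-Reasoning

size-prefix : ∀ X → ∣ X ∣ ≡ prefix total (indicator X)
size-prefix (false ∷ false ∷ false ∷ []) = refl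
size-prefix (false ∷ false ∷ true  ∷ []) = refl
size-prefix (false ∷ true  ∷ false ∷ []) = refl
size-prefix (false ∷ true  ∷ true  ∷ []) = refl
size-prefix (true  ∷ false ∷ false ∷ []) = refl
size-prefix (true  ∷ false ∷ true  ∷ []) = refl
size-prefix (true  ∷ true  ∷ false ∷ []) = refl
size-prefix (true  ∷ true  ∷ true  ∷ []) = refl

weight : Subset 3 → ℕ
weight X = prefix zero (indicator X) + prefix (suc zero) (indicator X)

weight-mono : ∀ {X Y} → indicator Y ⊴ indicator X → weight Y ≤ weight X
weight-mono Y⊴X = ℕP.+-mono-≤ (prefix-≤ Y⊴X zero) (prefix-≤ Y⊴X (suc zero))

rank1-weight : ∀ X → ∣ X ∣ ≡ 1 → rank1 X ≡ 2 ∸ weight X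
rank1-weight (false ∷ false ∷ false ∷ []) ()
rank1-weight (false ∷ false ∷ true  ∷ []) _ = refl
rank1-weight (false ∷ true  ∷ false ∷ []) _ = refl
rank1-weight (false ∷ true  ∷ true  ∷ []) ()
rank1-weight (true  ∷ false ∷ false ∷ []) _ = refl
rank1-weight (true  ∷ false ∷ true  ∷ []) ()
rank1-weight (true  ∷ true  ∷ false ∷ []) ()
rank1-weight (true  ∷ true  ∷ true  ∷ []) ()

rank2-weight : ∀ X → ∣ X ∣ ≡ 2 → rank2 X ≡ 3 ∸ weight X
rank2-weight (false ∷ false ∷ false ∷ []) ()
rank2-weight (false ∷ false ∷ true  ∷ []) ()
rank2-weight (false ∷ true  ∷ false ∷ []) ()
rank2-weight (false ∷ true  ∷ true  ∷ []) _ = refl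
rank2-weight (true  ∷ false ∷ false ∷ []) ()
rank2-weight (true  ∷ false ∷ true  ∷ []) _ = refl
rank2-weight (true  ∷ true  ∷ false ∷ []) _ = refl
rank2-weight (true  ∷ true  ∷ true  ∷ []) ()

rank1-antitone : ∀ {X Y} → ∣ X ∣ ≡ 1 → ∣ Y ∣ ≡ 1 → indicator Y ⊴ indicator X → rank1 X ≤ rank1 Y
rank1-antitone {X} {Y} ∣X∣≡1 ∣Y∣≡1 Y⊴X =
  subst₂ _≤_ (sym (rank1-weight X ∣X∣≡1)) (sym (rank1-weight Y ∣Y∣≡1))
    (ℕP.∸-monoʳ-≤ 2 (weight-mono Y⊴X))

rank2-antitone : ∀ {X Y} → ∣ X ∣ ≡ 2 → ∣ Y ∣ ≡ 2 → indicator Y ⊴ indicator X → rank2 X ≤ rank2 Y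
rank2-antitone {X} {Y} ∣X∣≡2 ∣Y∣≡2 Y⊴X =
  subst₂ _≤_ (sym (rank2-weight X ∣X∣≡2)) (sym (rank2-weight Y ∣Y∣≡2))
    (ℕP.∸-monoʳ-≤ 3 (weight-mono Y⊴X))

UpClosed : Subset 3 → Set
UpClosed (x ∷ y ∷ z ∷ []) = bit x ≤ bit y × bit y ≤ bit z

complement-antitone : ∀ {k c₁ c₂ b₁ b₂} → k ≡ c₁ + b₁ → k ≡ c₂ + b₂ → c₂ ≤ c₁ → b₁ ≤ b₂
complement-antitone {k} {c₁} {c₂} {b₁} {b₂} k≡c₁+b₁ k≡c₂+b₂ c₂≤c₁ =
  ℕP.+-cancelˡ-≤ c₂ b₁ b₂ (begin
    c₂ + b₁ ≤⟨ ℕP.+-monoˡ-≤ b₁ c₂≤c₁ ⟩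
    c₁ + b₁ ≡⟨ sym k≡c₁+b₁ ⟩
    k       ≡⟨ k≡c₂+b₂ ⟩
    c₂ + b₂ ∎)
  where open ℕP.≤-Reasoning

rect-strip-upClosed : ∀ {k B C} → B ≡ rect k → IsPartition C → VerticalStrip B C → UpClosed (dif B C)
rect-strip-upClosed refl (c₂≤c₁ , c₃≤c₂) (v₁ , v₂ , v₃) =
  complement-antitone (vstrip1-split v₁) (vstrip1-split v₂) c₂≤c₁ ,
  complement-antitone (vstrip1-split v₂) (vstrip1-split v₃) c₃≤c₂

upClosed-size1 : ∀ X → UpClosed X → ∣ X ∣ ≡ 1 → X ≡ ⁅ suc (suc zero) ⁆
upClosed-size1 (false ∷ false ∷ false ∷ []) _        ()
upClosed-size1 (false ∷ false ∷ true  ∷ []) _        _  = refl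
upClosed-size1 (false ∷ true  ∷ false ∷ []) (_ , ()) _
upClosed-size1 (false ∷ true  ∷ true  ∷ []) _        ()
upClosed-size1 (true  ∷ false ∷ _     ∷ []) (() , _) _
upClosed-size1 (true  ∷ true  ∷ false ∷ []) (_ , ()) _
upClosed-size1 (true  ∷ true  ∷ true  ∷ []) _        ()

upClosed-size2 : ∀ X → UpClosed X → ∣ X ∣ ≡ 2 → X ≡ ⁅ suc zero ⁆ ∪ ⁅ suc (suc zero) ⁆
upClosed-size2 (false ∷ false ∷ false ∷ []) _        ()
upClosed-size2 (false ∷ false ∷ true  ∷ []) _        ()
upClosed-size2 (false ∷ true  ∷ false ∷ []) (_ , ()) _
upClosed-size2 (false ∷ true  ∷ true  ∷ []) _        _  = refl
upClosed-size2 (true  ∷ false ∷ _     ∷ []) (() , _) _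
upClosed-size2 (true  ∷ true  ∷ false ∷ []) (_ , ()) _
upClosed-size2 (true  ∷ true  ∷ true  ∷ []) _        ()

stepwise : ∀ {a ℓ} {A : Set a} {_∼_ : A → A → Set ℓ} → Reflexive _∼_ → Transitive _∼_ →
  (f : ℕ → A) {lo hi : ℕ} → (∀ j → lo ≤ j → suc j ≤ hi → f j ∼ f (suc j)) →
  ∀ {j j′} → lo ≤ j → j ≤ j′ → j′ ≤ hi → f j ∼ f j′
stepwise {_∼_ = _∼_} refl∼ trans∼ f {lo} {hi} step {j} lo≤j j≤j′ j′≤hi =
  go (ℕP.≤⇒≤′ j≤j′) j′≤hi
  where
  go : ∀ {j′} → j ≤′ j′ → j′ ≤ hi → f j ∼ f j′
  go ≤′-refl _ = refl∼
  go (≤′-step {j′} j≤′j′) j′<hi =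
    trans∼ (go j≤′j′ (ℕP.<⇒≤ j′<hi)) (step j′ (ℕP.≤-trans lo≤j (ℕP.≤′⇒≤ j≤′j′)) j′<hi)

module RowStrips {n k γ} (G : CylGrowthDiagram n k γ) {i} (1≤i : 1 ≤ i) (i≤n : i ≤ n) where
  open CylGrowthDiagram G

  X : ℕ → Subset 3
  X j = dif (γ i j) (γ (suc i) j)

  upper∈St : ∀ {j} → suc i ≤ j → j ≤ i + n → InSt n i j
  upper∈St 1+i≤j j≤i+n = 1≤i , ℕP.m≤n⇒m≤1+n i≤n , ℕP.<⇒≤ 1+i≤j , j≤i+n

  lower∈St : ∀ {j} → suc i ≤ j → j ≤ i + n → InSt n (suc i) j
  lower∈St 1+i≤j j≤i+n = s≤s z≤n , s≤s i≤n , 1+i≤j , ℕP.m≤n⇒m≤1+n j≤i+n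

  1+i≤i+n : suc i ≤ i + n
  1+i≤i+n = ℕP.m<m+n i (ℕP.≤-trans 1≤i i≤n)

  X-step : ∀ j → suc i ≤ j → suc j ≤ i + n → indicator (X (suc j)) ⊴ indicator (X j)
  X-step j 1+i≤j 1+j≤i+n =
    local-rule-⊴ (vstrip-col i j ij 1+i,j) (vstrip-col i (suc j) i,1+j 1+i,1+j)
      (local-rule i j ij 1+i,j i,1+j 1+i,1+j)
    where
    ij : InSt n i j
    ij = upper∈St 1+i≤j (ℕP.<⇒≤ 1+j≤i+n)
    1+i,j : InSt n (suc i) j
    1+i,j = lower∈St 1+i≤j (ℕP.<⇒≤ 1+j≤i+n)
    i,1+j : InSt n i (suc j)
    i,1+j = upper∈St (ℕP.m≤n⇒m≤1+n 1+i≤j) 1+j≤i+n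
    1+i,1+j : InSt n (suc i) (suc j)
    1+i,1+j = lower∈St (ℕP.m≤n⇒m≤1+n 1+i≤j) 1+j≤i+n

  X-descends : ∀ {j j′} → suc i ≤ j → j ≤ j′ → j′ ≤ i + n → indicator (X j′) ⊴ indicator (X j)
  X-descends = stepwise {_∼_ = λ S T → indicator T ⊴ indicator S} ⊴-refl (flip ⊴-trans) X X-step

  X-first : ∀ {shape} → γ i (suc i) ≡ shape → X (suc i) ≡ dif shape empty
  X-first γ≡shape =
    cong₂ dif γ≡shape (diag-empty (suc i) (lower∈St ℕP.≤-refl 1+i≤i+n))

  X-size : ∀ {shape} → γ i (suc i) ≡ shape →
    ∀ j → suc i ≤ j → j ≤ i + n → ∣ X j ∣ ≡ ∣ dif shape empty ∣
  X-size {shape} γ≡shape j 1+i≤j j≤i+n = begin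
    ∣ X j ∣                              ≡⟨ size-prefix (X j) ⟩
    prefix total (indicator (X j))       ≡⟨ total-≡ (X-descends {suc i} {j} ℕP.≤-refl 1+i≤j j≤i+n) ⟩
    prefix total (indicator (X (suc i))) ≡⟨ sym (size-prefix (X (suc i))) ⟩
    ∣ X (suc i) ∣                        ≡⟨ cong ∣_∣ (X-first γ≡shape) ⟩
    ∣ dif shape empty ∣                  ∎
    where open ≡-Reasoning

  X-last-upClosed : UpClosed (X (i + n))
  X-last-upClosed =
    rect-strip-upClosed (top-shape i (upper∈St 1+i≤i+n ℕP.≤-refl))
      (partition (suc i) (i + n) (lower∈St 1+i≤i+n ℕP.≤-refl))
      (vstrip-col i (i + n) (upper∈St 1+i≤i+n ℕP.≤-refl) (lower∈St 1+i≤i+n ℕP.≤-refl))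

proposition4p5 : ∀ (n k : ℕ) (γ : ℕ → ℕ → Triple) → CylGrowthDiagram n k γ →
    ∀ (i : ℕ) → 1 ≤ i → i ≤ n →
      ((γ i (suc i) ≡ (1 , 0 , 0) →
          (dif (γ i (suc i)) (γ (suc i) (suc i)) ≡ ⁅ zero ⁆)
        × (dif (γ i (i + n)) (γ (suc i) (i + n)) ≡ ⁅ suc (suc zero) ⁆)
        × (∀ j → suc i ≤ j → j ≤ i + n → ∣ dif (γ i j) (γ (suc i) j) ∣ ≡ 1)
        × (∀ j j′ → suc i ≤ j → j ≤ j′ → j′ ≤ i + n →
             rank1 (dif (γ i j) (γ (suc i) j)) ≤ rank1 (dif (γ i j′) (γ (suc i) j′))))
      × (γ i (suc i) ≡ (1 , 1 , 0) →
          (dif (γ i (suc i)) (γ (suc i) (suc i)) ≡ ⁅ zero ⁆ ∪ ⁅ suc zero ⁆)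
        × (dif (γ i (i + n)) (γ (suc i) (i + n)) ≡ ⁅ suc zero ⁆ ∪ ⁅ suc (suc zero) ⁆)
        × (∀ j → suc i ≤ j → j ≤ i + n → ∣ dif (γ i j) (γ (suc i) j) ∣ ≡ 2)
        × (∀ j j′ → suc i ≤ j → j ≤ j′ → j′ ≤ i + n →
             rank2 (dif (γ i j) (γ (suc i) j)) ≤ rank2 (dif (γ i j′) (γ (suc i) j′)))))
proposition4p5 n k γ G i 1≤i i≤n =
  (λ γ≡ → X-first γ≡
        , upClosed-size1 (X (i + n)) X-last-upClosed (X-size γ≡ (i + n) 1+i≤i+n ℕP.≤-refl)
        , X-size γ≡
        , λ j j′ 1+i≤j j≤j′ j′≤i+n →
            rank1-antitone (X-size γ≡ j 1+i≤j (ℕP.≤-trans j≤j′ j′≤i+n))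
              (X-size γ≡ j′ (ℕP.≤-trans 1+i≤j j≤j′) j′≤i+n) (X-descends 1+i≤j j≤j′ j′≤i+n))
  , (λ γ≡ → X-first γ≡
        , upClosed-size2 (X (i + n)) X-last-upClosed (X-size γ≡ (i + n) 1+i≤i+n ℕP.≤-refl)
        , X-size γ≡
        , λ j j′ 1+i≤j j≤j′ j′≤i+n →
            rank2-antitone (X-size γ≡ j 1+i≤j (ℕP.≤-trans j≤j′ j′≤i+n))
              (X-size γ≡ j′ (ℕP.≤-trans 1+i≤j j≤j′) j′≤i+n) (X-descends 1+i≤j j≤j′ j′≤i+n))
  where open RowStrips G 1≤i i≤n
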